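{- Let $\varphi = [\mathrm{TC}_{\vec X,\vec X'}\theta](\vec Y,\vec Y')$ where $\theta$ is an existential first-order formula and $\vec X,\vec X',\vec Y,\vec Y'$ are tuples of second-order variables. Then there is $k\in\mathbb N$ such that $\varphi$ is equivalent (over all finite appropriate structures) to $[\mathrm{TC}^k_{\vec X,\vec X'}\theta](\vec Y,\vec Y')$.
   Context: A structure over a finite set $\tau$ of variables is a pair $(A,I)$, $A$ finite nonempty, $I$ interpreting first-order variables as elements and $m$-ary second-order variables as subsets of $A^m$. $\vec X,\vec X'$ are disjoint tuples of second-order variables of the same sort (same length and positionwise same arity), and $\vec Y,\vec Y'$ are of that same sort. $\mathfrak A=(A,I)\models[\mathrm{TC}_{\vec X,\vec X'}\theta](\vec Y,\vec Y')$ iff there exist $n\ge 1$ and tuples of relations $\vec B_0,\dots,\vec B_n$ on $A$ (of the sort of $\vec X$) with $\vec B_0=I(\vec Y)$, $\vec B_n=I(\vec Y')$ and $\mathfrak A[\vec B_i/\vec X,\vec B_{i+1}/\vec X']\models\theta$ for all $i<n$. $[\mathrm{TC}^k_{\vec X,\vec X'}\theta](\vec Y,\vec Y')$ has the same semantics except that $n$ is restricted to $1\le n\le k$. An existential first-order formula is a first-order formula (over atoms $x=y$ and $X(x_1,\dots,x_m)$) in which existential quantifiers occur only positively. -}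

module Defs where

open import Data.Nat using (ℕ; zero; suc; _≤_; _<_; _≟_)
open import Data.Fin using (Fin; zero; suc)
open import Data.Vec using (Vec; []; _∷_; lookup; map)
open import Data.Bool using (Bool; true)
open import Data.Product using (Σ; _×_; _,_)
open import Data.Empty using (⊥)
open import Relation.Nullary using (¬_; yes; no)
open import Relation.Binary.PropositionalEquality using (_≡_; refl)

-- First-order variables are named by natural numbers.
-- A second-order variable is a pair (name , arity) of natural numbers;
-- two second-order variables are equal iff both name and arity agree.

Rel : ℕ → ℕ → Set
Rel n m = Vec (Fin (suc n)) m → Bool

record Structure (n : ℕ) : Set where
  constructor mkStructure
  field
    I₁ : ℕ → Fin (suc n)
    I₂ : ℕ → (m : ℕ) → Rel n m
open Structure public

data Formula : Set where
  eqF  : ℕ → ℕ → Formula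
  relF : (X : ℕ) (m : ℕ) → Vec ℕ m → Formula
  negF : Formula → Formula
  andF : Formula → Formula → Formula
  exF  : ℕ → Formula → Formula

orF : Formula → Formula → Formula
orF φ ψ = negF (andF (negF φ) (negF ψ))

allF : ℕ → Formula → Formula
allF x φ = negF (exF x (negF φ))

-- Existential formulas: existential quantifiers occur only positively,
-- i.e. under an even number of negations.
mutual
  data Pos : Formula → Set where
    eqP  : ∀ {x y} → Pos (eqF x y)
    relP : ∀ {X m xs} → Pos (relF X m xs)
    negP : ∀ {φ} → Neg φ → Pos (negF φ)
    andP : ∀ {φ ψ} → Pos φ → Pos ψ → Pos (andF φ ψ)
    exP  : ∀ {x φ} → Pos φ → Pos (exF x φ)

  data Neg : Formula → Set where
    eqN  : ∀ {x y} → Neg (eqF x y)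
    relN : ∀ {X m xs} → Neg (relF X m xs)
    negN : ∀ {φ} → Pos φ → Neg (negF φ)
    andN : ∀ {φ ψ} → Neg φ → Neg ψ → Neg (andF φ ψ)

Existential : Formula → Set
Existential = Pos

set₁ : ∀ {n} → Structure n → ℕ → Fin (suc n) → Structure n
set₁ 𝔄 x a = mkStructure (λ y → f y (x ≟ y)) (I₂ 𝔄)
  where
  f : ∀ y → _ → Fin _
  f y (yes _) = a
  f y (no _)  = I₁ 𝔄 y

Sat : ∀ {n} → Structure n → Formula → Set
Sat 𝔄 (eqF x y)      = I₁ 𝔄 x ≡ I₁ 𝔄 y
Sat 𝔄 (relF X m xs)  = I₂ 𝔄 X m (map (I₁ 𝔄) xs) ≡ true
Sat 𝔄 (negF φ)       = ¬ Sat 𝔄 φ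
Sat 𝔄 (andF φ ψ)     = Sat 𝔄 φ × Sat 𝔄 ψ
Sat {n} 𝔄 (exF x φ)  = Σ (Fin (suc n)) λ a → Sat (set₁ 𝔄 x a) φ

-- Tuples of second-order variables of sort ar : Vec ℕ l (the arities) are
-- given by their names X : Vec ℕ l; the i-th variable is (lookup X i , lookup ar i).
-- A tuple of relations of sort ar:
RelTuple : ∀ (n : ℕ) {l} → Vec ℕ l → Set
RelTuple n ar = (i : Fin _) → Rel n (lookup ar i)

EqR : ∀ {n l} (ar : Vec ℕ l) → RelTuple n ar → RelTuple n ar → Set
EqR ar B C = ∀ i v → B i v ≡ C i v

valT : ∀ {n l} → Structure n → (ar : Vec ℕ l) → Vec ℕ l → RelTuple n ar
valT 𝔄 ar Y i = I₂ 𝔄 (lookup Y i) (lookup ar i)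

updI₂ : ∀ {n l} (ar : Vec ℕ l) (X : Vec ℕ l) → RelTuple n ar →
        (ℕ → (m : ℕ) → Rel n m) → ℕ → (m : ℕ) → Rel n m
updI₂ [] [] B I y m = I y m
updI₂ (a ∷ ar) (x ∷ X) B I y m with x ≟ y | a ≟ m
... | yes _ | yes refl = B zero
... | _     | _        = updI₂ ar X (λ i → B (suc i)) I y m

set₂ : ∀ {n l} → Structure n → (ar : Vec ℕ l) → Vec ℕ l → RelTuple n ar → Structure n
set₂ 𝔄 ar X B = mkStructure (I₁ 𝔄) (updI₂ ar X B (I₂ 𝔄))

Distinct : ∀ {l} → Vec ℕ l → Vec ℕ l → Set
Distinct ar X = ∀ i j → ¬ (i ≡ j) → ¬ (lookup X i ≡ lookup X j × lookup ar i ≡ lookup ar j)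

Disjoint : ∀ {l} → Vec ℕ l → Vec ℕ l → Vec ℕ l → Set
Disjoint ar X X' = ∀ i j → ¬ (lookup X i ≡ lookup X' j × lookup ar i ≡ lookup ar j)

Step : ∀ {n l} → Structure n → (ar X X' : Vec ℕ l) → Formula →
       RelTuple n ar → RelTuple n ar → Set
Step 𝔄 ar X X' θ B B' = Sat (set₂ (set₂ 𝔄 ar X' B') ar X B) θ

Path : ∀ {n l} → Structure n → (ar X X' : Vec ℕ l) → Formula →
       (Y Y' : Vec ℕ l) → ℕ → Set
Path {n} 𝔄 ar X X' θ Y Y' len =
  Σ (ℕ → RelTuple n ar) λ Bs →
    EqR ar (Bs 0) (valT 𝔄 ar Y) × EqR ar (Bs len) (valT 𝔄 ar Y') ×
    (∀ i → i < len → Step 𝔄 ar X X' θ (Bs i) (Bs (suc i)))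

SatTC : ∀ {n l} → Structure n → (ar X X' : Vec ℕ l) → Formula → (Y Y' : Vec ℕ l) → Set
SatTC 𝔄 ar X X' θ Y Y' = Σ ℕ λ len → 1 ≤ len × Path 𝔄 ar X X' θ Y Y' len

SatTCk : ∀ {n l} → ℕ → Structure n → (ar X X' : Vec ℕ l) → Formula → (Y Y' : Vec ℕ l) → Set
SatTCk k 𝔄 ar X X' θ Y Y' = Σ ℕ λ len → 1 ≤ len × len ≤ k × Path 𝔄 ar X X' θ Y Y' len

module Submission where

-- An existential formula that holds is already forced by the atomic facts its
-- witnesses inspect, at most one for each relational atom. Hence a step B → B′
-- of a θ-path only depends on B and B′ at c = 2 · relAtoms θ points, and an
-- intermediate B_{i+1} is read at no more than 2c points by its two adjacent
-- steps. Among more than compatBound (2c) such partial colourings, two, at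
-- positions a < b, agree on their common points: if the first one conflicts with
-- all later ones, then by pigeonhole many of them conflict with it at the same
-- point, hence agree there, and the domains shrink. Gluing B_{a+1} and B_{b+1}
-- gives C with B_a → C → B_{b+2}, a shorter path; so paths of length at most
-- compatBound (2c) + 1 suffice.

open import Defs
open import Data.Nat using (ℕ; zero; suc; _+_; _*_; _≤_; _<_; z≤n; s≤s; _≤?_; _<?_; _≟_)
open import Data.Nat.Properties
open import Data.Nat.Induction using (<-rec)
open import Data.Bool using (Bool; true)
import Data.Bool.Properties as Bool
open import Data.Fin using (Fin; zero; suc)
import Data.Fin.Properties as Fin
open import Data.Vec using (Vec; []; _∷_; lookup; map)
import Data.Vec.Properties as Vec
import Data.List as List
open import Data.List using (List; []; _∷_; _++_; length; filter; concatMap; upTo)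
open import Data.List.Properties using (length-++; length-map; length-upTo; filter-notAll)
open import Data.List.Relation.Unary.All as All using (All; []; _∷_)
open import Data.List.Relation.Unary.All.Properties using (¬Any⇒All¬)
open import Data.List.Relation.Unary.Any as Any using (Any; here; there)
open import Data.List.Relation.Unary.AllPairs using (AllPairs; _∷_)
import Data.List.Relation.Unary.AllPairs.Properties as AllPairs
open import Data.List.Relation.Binary.Subset.Propositional using (_⊆_)
open import Data.List.Relation.Binary.Sublist.Propositional.Properties
  using (length-mono-≤; filter⁺; filter-⊆)
open import Data.List.Membership.Propositional using (_∈_; find; lose)
open import Data.List.Membership.Propositional.Properties
  using (∈-++⁺ˡ; ∈-++⁺ʳ; ∈-map⁺; ∈-filter⁺; ∈-filter⁻; ∈-upTo⁻; ∈-concatMap⁺)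
import Data.List.Membership.DecPropositional as DecMembership
open import Data.Product using (Σ; _×_; _,_; proj₁; proj₂; curry; uncurry)
import Data.Product.Properties as Product
open import Data.Sum using (_⊎_; inj₁; inj₂)
open import Data.Empty using (⊥-elim)
open import Function using (_∘_; id)
open import Function.Bundles using (_⇔_; mk⇔; Equivalence)
open import Relation.Nullary using (¬_; Dec; yes; no; ¬?; contradiction)
open import Relation.Nullary.Decidable using (_×-dec_; decidable-stable)
open import Relation.Unary using (Decidable)
open import Relation.Unary.Properties using (∁?)
open import Relation.Binary.Definitions using (DecidableEquality)
open import Relation.Binary.PropositionalEquality
  using (_≡_; _≢_; _≗_; refl; sym; trans; cong; cong-app; subst)

module _ {A B : Set} where

  length-filter+filter∁ : {Q : A → Set} (Q? : Decidable Q) (xs : List A) →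
                          length (filter Q? xs) + length (filter (∁? Q?) xs) ≡ length xs
  length-filter+filter∁ Q? [] = refl
  length-filter+filter∁ Q? (x ∷ xs) with Q? x
  ... | yes _ = cong suc (length-filter+filter∁ Q? xs)
  ... | no _  = trans (+-suc _ _) (cong suc (length-filter+filter∁ Q? xs))

  length-filter-filter : {Q Q′ : A → Set} (Q? : Decidable Q) (Q′? : Decidable Q′) (xs : List A) →
                         length (filter Q? (filter Q′? xs)) ≤ length (filter Q? xs)
  length-filter-filter Q? Q′? xs = length-mono-≤ (filter⁺ Q? Q? (λ { refl q → q }) (filter-⊆ Q′? xs))

  pigeonhole : {Q : B → A → Set} (Q? : ∀ t → Decidable (Q t)) (F : ℕ) (T : List B) (xs : List A) →
               All (λ x → Any (λ t → Q t x) T) xs → length T * F < length xs →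
               Any (λ t → F < length (filter (Q? t) xs)) T
  pigeonhole Q? F [] (x ∷ xs) (() ∷ _) _
  pigeonhole {Q} Q? F (t ∷ T) xs covered long with F <? length (filter (Q? t) xs)
  ... | yes many = here many
  ... | no few = there (Any.map (λ many → <-≤-trans many (length-filter-filter (Q? _) (∁? (Q? t)) xs))
                                 (pigeonhole Q? F T rest covered-rest long-rest))
    where
    rest : List A
    rest = filter (∁? (Q? t)) xs
    covered-rest : All (λ x → Any (λ t′ → Q t′ x) T) rest
    covered-rest = All.tabulate λ x∈rest →
      let x∈xs , ¬Qtx = ∈-filter⁻ (∁? (Q? t)) x∈rest
      in Any.tail ¬Qtx (All.lookup covered x∈xs)
    long-rest : length T * F < length rest
    long-rest = +-cancelˡ-< F (length T * F) (length rest) (begin-strict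
      F + length T * F                             <⟨ long ⟩
      length xs                                    ≡⟨ length-filter+filter∁ (Q? t) xs ⟨
      length (filter (Q? t) xs) + length rest      ≤⟨ +-monoˡ-≤ (length rest) (≮⇒≥ few) ⟩
      F + length rest                              ∎)
      where open ≤-Reasoning

compatBound : ℕ → ℕ
compatBound zero    = 1
compatBound (suc D) = suc (suc D * compatBound D)

module _ {P I : Set} (_≟P_ : DecidableEquality P) (c : I → P → Bool) where

  open DecMembership _≟P_ using (_∈?_)

  Compatible : (I → List P) → I → I → Set
  Compatible dom i j = ∀ {t} → t ∈ dom i → t ∈ dom j → c i t ≡ c j t

  Conflict : (I → List P) → I → P → I → Set
  Conflict dom i t j = t ∈ dom j × c j t ≢ c i t

  conflict? : ∀ dom i t → Decidable (Conflict dom i t)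
  conflict? dom i t j = (t ∈? dom j) ×-dec ¬? (c j t Bool.≟ c i t)

  conflict-or-compatible : ∀ dom i j → Any (λ t → Conflict dom i t j) (dom i) ⊎ Compatible dom i j
  conflict-or-compatible dom i j with Any.any? (λ t → conflict? dom i t j) (dom i)
  ... | yes conflict = inj₁ conflict
  ... | no none = inj₂ λ {t} t∈i t∈j →
    decidable-stable (c i t Bool.≟ c j t) (λ ne → none (lose t∈i (t∈j , ne ∘ sym)))

  compatible? : ∀ dom i j → Dec (Compatible dom i j)
  compatible? dom i j with conflict-or-compatible dom i j
  ... | inj₂ compatible = yes compatible
  ... | inj₁ conflict = no λ compatible →
    let t , t∈i , t∈j , ne = find conflict in ne (sym (compatible t∈i t∈j))

  incompatible⇒conflict : ∀ dom i j → ¬ Compatible dom i j → Any (λ t → Conflict dom i t j) (dom i)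
  incompatible⇒conflict dom i j incompatible with conflict-or-compatible dom i j
  ... | inj₁ conflict = conflict
  ... | inj₂ compatible = ⊥-elim (incompatible compatible)

  without : P → List P → List P
  without t = filter (λ u → ¬? (u ≟P t))

  compatible-without : ∀ dom {i j} t → c i t ≡ c j t →
                       Compatible (without t ∘ dom) i j → Compatible dom i j
  compatible-without dom {i} {j} t same compatible {u} u∈i u∈j with u ≟P t
  ... | yes refl = same
  ... | no u≢t = compatible (∈-filter⁺ (λ u → ¬? (u ≟P t)) u∈i u≢t)
                            (∈-filter⁺ (λ u → ¬? (u ≟P t)) u∈j u≢t)

  CompatiblePair : (I → List P) → (I → I → Set) → List I → Set
  CompatiblePair dom _≺_ Is = Σ I λ i → Σ I λ j → i ≺ j × i ∈ Is × j ∈ Is × Compatible dom i j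

  compatiblePair : ∀ {_≺_ : I → I → Set} D dom (Is : List I) → AllPairs _≺_ Is →
                   All (λ i → length (dom i) ≤ D) Is → compatBound D < length Is →
                   CompatiblePair dom _≺_ Is
  compatiblePair zero dom (i ∷ j ∷ Is) (i≺ ∷ _) (empty ∷ _) _ =
    i , j , All.head i≺ , here refl , there (here refl) , λ t∈i → contradiction t∈i (∉-empty empty)
    where
    ∉-empty : ∀ {xs : List P} {t} → length xs ≤ 0 → ¬ t ∈ xs
    ∉-empty {[]} _ ()
  compatiblePair zero dom (i ∷ []) _ _ (s≤s ())
  compatiblePair {_≺_} (suc D) dom (i ∷ Is) (i≺ ∷ sorted) (small ∷ bounds) (s≤s long)
    with Any.any? (compatible? dom i) Is
  ... | yes found = let j , j∈ , compatible = find found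
                    in i , j , All.lookup i≺ j∈ , here refl , there j∈ , compatible
  ... | no none = let t , _ , many = find (pigeonhole (conflict? dom i) (compatBound D) (dom i) Is conflicts
                                                      (≤-<-trans (*-monoˡ-≤ (compatBound D) small) long))
                  in pairAmongConflicting t many
    where
    conflicts : All (λ j → Any (λ t → Conflict dom i t j) (dom i)) Is
    conflicts = All.map (incompatible⇒conflict dom i _) (¬Any⇒All¬ Is none)
    pairAmongConflicting : ∀ t → compatBound D < length (filter (conflict? dom i t) Is) →
                           CompatiblePair dom _≺_ (i ∷ Is)
    pairAmongConflicting t many =
      let i′ , j′ , i′≺j′ , i′∈ , j′∈ , compatible =
            compatiblePair D (without t ∘ dom) G (AllPairs.filter⁺ (conflict? dom i t) sorted) shrunk many
          i′∈Is , (_ , ne-i′) = ∈-filter⁻ (conflict? dom i t) i′∈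
          j′∈Is , (_ , ne-j′) = ∈-filter⁻ (conflict? dom i t) j′∈
      in i′ , j′ , i′≺j′ , there i′∈Is , there j′∈Is ,
         compatible-without dom t (trans (Bool.¬-not ne-i′) (sym (Bool.¬-not ne-j′))) compatible
      where
      G : List I
      G = filter (conflict? dom i t) Is
      shrunk : All (λ j → length (without t (dom j)) ≤ D) G
      shrunk = All.tabulate λ j∈G →
        let j∈Is , (t∈j , _) = ∈-filter⁻ (conflict? dom i t) j∈G
        in ≤-pred (<-≤-trans (filter-notAll _ _ (Any.map (λ t≡ ≢t → ≢t (sym t≡)) t∈j))
                              (All.lookup bounds j∈Is))

Chain : {A : Set} → (A → A → Set) → (ℕ → A) → ℕ → Set
Chain R s len = ∀ i → i < len → R (s i) (s (suc i))

-- splice p d s c is the sequence s₀ … s_p, c, s_{p+d+2}, s_{p+d+3}, … :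
-- c replaces the d + 1 entries s_{p+1} … s_{p+d+1}.
splice : {A : Set} → ℕ → ℕ → (ℕ → A) → A → ℕ → A
splice p       d s c zero          = s zero
splice zero    d s c (suc zero)    = c
splice zero    d s c (suc (suc i)) = s (suc (suc i) + d)
splice (suc p) d s c (suc i)       = splice p d (s ∘ suc) c i

module _ {A : Set} {R : A → A → Set} where

  chain-splice : ∀ p d r (s : ℕ → A) c → Chain R s (suc (suc p) + d + r) →
                 R (s p) c → R c (s (suc (suc p) + d)) → Chain R (splice p d s c) (suc (suc p) + r)
  chain-splice zero d r s c chain into out zero _ = into
  chain-splice zero d r s c chain into out (suc zero) _ = out
  chain-splice zero d r s c chain into out (suc (suc i)) (s≤s (s≤s i<r)) =
    chain (suc (suc i) + d) (s≤s (s≤s (subst (i + d <_) (+-comm r d) (+-monoˡ-< d i<r))))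
  chain-splice (suc p) d r s c chain into out zero _ = chain zero (s≤s z≤n)
  chain-splice (suc p) d r s c chain into out (suc i) (s≤s i<) =
    chain-splice p d r (s ∘ suc) c (λ j j< → chain (suc j) (s≤s j<)) into out i i<

splice-last : ∀ {A : Set} p d r (s : ℕ → A) c → splice p d s c (suc (suc p) + r) ≡ s (suc (suc p) + d + r)
splice-last zero    d r s c = cong (λ i → s (suc (suc i))) (+-comm r d)
splice-last (suc p) d r s c = splice-last p d r (s ∘ suc) c

module _ {P : Set} where

  Agree : List P → (P → Bool) → (P → Bool) → Set
  Agree T f g = ∀ {t} → t ∈ T → f t ≡ g t

  Local : ℕ → ((P → Bool) → (P → Bool) → Set) → Set
  Local D R = ∀ {B B′} → R B B′ →
              Σ (List P) λ T → length T ≤ D × (∀ {C C′} → Agree T C B → Agree T C′ B′ → R C C′)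

  Walk : ((P → Bool) → (P → Bool) → Set) → (P → Bool) → (P → Bool) → ℕ → Set
  Walk R x y len = Σ (ℕ → P → Bool) λ s → s 0 ≗ x × s len ≗ y × Chain R s len

  ShorterWalk : ((P → Bool) → (P → Bool) → Set) → (P → Bool) → (P → Bool) → ℕ → Set
  ShorterWalk R x y len = Σ ℕ λ len′ → 1 ≤ len′ × len′ < len × Walk R x y len′

  bypass : ∀ {R x y len} a b (s : ℕ → P → Bool) c → a < b → suc b < len →
           s 0 ≗ x → s len ≗ y → Chain R s len → R (s a) c → R c (s (suc (suc b))) →
           ShorterWalk R x y len
  bypass {R} a b s c a<b b<len first last chain into out
    with d , refl ← m≤n⇒∃[o]m+o≡n (<⇒≤ a<b) | r , refl ← m≤n⇒∃[o]m+o≡n b<len =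
    suc (suc a) + r , s≤s z≤n , +-monoˡ-< r (s≤s (s≤s a<b)) ,
    splice a d s c , first , (λ t → trans (cong-app (splice-last a d r s c) t) (last t)) ,
    chain-splice {R = R} a d r s c chain into out

module _ {P : Set} (_≟P_ : DecidableEquality P) {D : ℕ} {R : (P → Bool) → (P → Bool) → Set}
         (local : Local D R) where

  open DecMembership _≟P_ using (_∈?_)

  shorten : ∀ {x y len} → suc (compatBound (D + D)) < len → Walk R x y len → ShorterWalk R x y len
  shorten {x} {y} {suc len₀} (s≤s long) (s , first , last , chain) =
    shortcut (compatiblePair _≟P_ (s ∘ suc) (D + D) dom (upTo len₀)
               (AllPairs.applyUpTo⁺₁ id len₀ (λ i<j _ → i<j))
               (All.tabulate (λ {i} _ → dom-length i))
               (<-≤-trans long (≤-reflexive (sym (length-upTo len₀)))))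
    where
    support : ∀ i → Σ (List P) λ T → length T ≤ D ×
              (i < suc len₀ → ∀ {C C′} → Agree T C (s i) → Agree T C′ (s (suc i)) → R C C′)
    support i with i <? suc len₀
    ... | yes i<len = let T , small , supports = local (chain i i<len) in T , small , λ _ → supports
    ... | no i≮len = [] , z≤n , λ i<len → contradiction i<len i≮len

    T : ℕ → List P
    T i = proj₁ (support i)

    T-short : ∀ i → length (T i) ≤ D
    T-short i = proj₁ (proj₂ (support i))

    T-supports : ∀ i → i < suc len₀ →
                 ∀ {C C′} → Agree (T i) C (s i) → Agree (T i) C′ (s (suc i)) → R C C′
    T-supports i = proj₂ (proj₂ (support i))

    -- Entry i + 1 of the walk is constrained only by the supports of its two adjacent steps.
    dom : ℕ → List P
    dom i = T i ++ T (suc i)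

    dom-length : ∀ i → length (dom i) ≤ D + D
    dom-length i = ≤-trans (≤-reflexive (length-++ (T i))) (+-mono-≤ (T-short i) (T-short (suc i)))

    shortcut : CompatiblePair _≟P_ (s ∘ suc) dom _<_ (upTo len₀) → ShorterWalk R x y (suc len₀)
    shortcut (a , b , a<b , a∈ , b∈ , compatible) =
      bypass {R = R} a b s glued a<b (s≤s (∈-upTo⁻ b∈)) first last chain
        (T-supports a (m<n⇒m<1+n (∈-upTo⁻ a∈)) (λ _ → refl) glued-a)
        (T-supports (suc b) (s≤s (∈-upTo⁻ b∈)) glued-b (λ _ → refl))
      where
      glued : P → Bool
      glued t with t ∈? T a
      ... | yes _ = s (suc a) t
      ... | no _  = s (suc b) t
      glued-a : Agree (T a) glued (s (suc a))
      glued-a {t} t∈ with t ∈? T a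
      ... | yes _ = refl
      ... | no t∉ = contradiction t∈ t∉
      glued-b : Agree (T (suc b)) glued (s (suc b))
      glued-b {t} t∈ with t ∈? T a
      ... | yes t∈a = compatible (∈-++⁺ˡ t∈a) (∈-++⁺ʳ (T b) t∈)
      ... | no _ = refl

shortenToBound : ∀ {Q : ℕ → Set} k →
                 (∀ {len} → k < len → Q len → Σ ℕ λ len′ → 1 ≤ len′ × len′ < len × Q len′) →
                 ∀ {len} → 1 ≤ len → Q len → Σ ℕ λ len′ → 1 ≤ len′ × len′ ≤ k × Q len′
shortenToBound {Q} k shorten {len} = <-rec Bounded step len
  where
  Bounded : ℕ → Set
  Bounded len = 1 ≤ len → Q len → Σ ℕ λ len′ → 1 ≤ len′ × len′ ≤ k × Q len′
  step : ∀ len → (∀ {len′} → len′ < len → Bounded len′) → Bounded len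
  step len shorter 1≤len q with len ≤? k
  ... | yes len≤k = len , 1≤len , len≤k , q
  ... | no len≰k = let len′ , 1≤len′ , len′<len , q′ = shorten (≰⇒> len≰k) q
                   in shorter len′<len 1≤len′ q′

sat? : ∀ {n} (𝔄 : Structure n) φ → Dec (Sat 𝔄 φ)
sat? 𝔄 (eqF x y)     = I₁ 𝔄 x Fin.≟ I₁ 𝔄 y
sat? 𝔄 (relF X m xs) = I₂ 𝔄 X m (map (I₁ 𝔄) xs) Bool.≟ true
sat? 𝔄 (negF φ)      = ¬? (sat? 𝔄 φ)
sat? 𝔄 (andF φ ψ)    = sat? 𝔄 φ ×-dec sat? 𝔄 ψ
sat? 𝔄 (exF x φ)     = Fin.any? (λ a → sat? (set₁ 𝔄 x a) φ)

relAtoms : Formula → ℕ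
relAtoms (eqF _ _)    = 0
relAtoms (relF _ _ _) = 1
relAtoms (negF φ)     = relAtoms φ
relAtoms (andF φ ψ)   = relAtoms φ + relAtoms ψ
relAtoms (exF _ φ)    = relAtoms φ

Atom : ℕ → Set
Atom n = Σ ℕ λ X → Σ ℕ λ m → Vec (Fin (suc n)) m

module _ {n : ℕ} where

  AgreeOn : List (Atom n) → Structure n → Structure n → Set
  AgreeOn As 𝔄 𝔅 = I₁ 𝔅 ≗ I₁ 𝔄 × (∀ {X m v} → (X , m , v) ∈ As → I₂ 𝔅 X m v ≡ I₂ 𝔄 X m v)

  AgreeOn-⊆ : ∀ {As Bs 𝔄 𝔅} → As ⊆ Bs → AgreeOn Bs 𝔄 𝔅 → AgreeOn As 𝔄 𝔅
  AgreeOn-⊆ As⊆Bs (same₁ , same₂) = same₁ , same₂ ∘ As⊆Bs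

  AgreeOn-set₁ : ∀ {As 𝔄 𝔅} x a → AgreeOn As 𝔄 𝔅 → AgreeOn As (set₁ 𝔄 x a) (set₁ 𝔅 x a)
  AgreeOn-set₁ {𝔄 = 𝔄} {𝔅} x a (same₁ , same₂) = same₁′ , same₂
    where
    same₁′ : I₁ (set₁ 𝔅 x a) ≗ I₁ (set₁ 𝔄 x a)
    same₁′ y with x ≟ y
    ... | yes _ = refl
    ... | no _  = same₁ y

  Supported : Structure n → ℕ → (Structure n → Set) → Set
  Supported 𝔄 k G = Σ (List (Atom n)) λ As → length As ≤ k × (∀ 𝔅 → AgreeOn As 𝔄 𝔅 → G 𝔅)

  relF-agree : ∀ {𝔄 𝔅} X m xs → AgreeOn ((X , m , map (I₁ 𝔄) xs) ∷ []) 𝔄 𝔅 →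
               I₂ 𝔅 X m (map (I₁ 𝔅) xs) ≡ I₂ 𝔄 X m (map (I₁ 𝔄) xs)
  relF-agree X m xs (same₁ , same₂) rewrite Vec.map-cong same₁ xs = same₂ (here refl)

  mutual
    support⁺ : ∀ {φ} → Pos φ → (𝔄 : Structure n) → Sat 𝔄 φ →
               Supported 𝔄 (relAtoms φ) (λ 𝔅 → Sat 𝔅 φ)
    support⁺ {eqF x y} eqP 𝔄 x≡y =
      [] , z≤n , λ 𝔅 (same₁ , _) → trans (same₁ x) (trans x≡y (sym (same₁ y)))
    support⁺ {relF X m xs} relP 𝔄 holds =
      (X , m , map (I₁ 𝔄) xs) ∷ [] , ≤-refl , λ 𝔅 agree → trans (relF-agree X m xs agree) holds
    support⁺ (negP φ⁻) 𝔄 fails = support⁻ φ⁻ 𝔄 fails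
    support⁺ {andF φ ψ} (andP φ⁺ ψ⁺) 𝔄 (φ-holds , ψ-holds) =
      let As , |As| , φ-supported = support⁺ φ⁺ 𝔄 φ-holds
          Bs , |Bs| , ψ-supported = support⁺ ψ⁺ 𝔄 ψ-holds
      in As ++ Bs , ≤-trans (≤-reflexive (length-++ As)) (+-mono-≤ |As| |Bs|) ,
         λ 𝔅 agree → φ-supported 𝔅 (AgreeOn-⊆ ∈-++⁺ˡ agree) ,
                     ψ-supported 𝔅 (AgreeOn-⊆ (∈-++⁺ʳ As) agree)
    support⁺ {exF x φ} (exP φ⁺) 𝔄 (a , holds) =
      let As , |As| , supported = support⁺ φ⁺ (set₁ 𝔄 x a) holds
      in As , |As| , λ 𝔅 agree → a , supported (set₁ 𝔅 x a) (AgreeOn-set₁ x a agree)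

    support⁻ : ∀ {φ} → Neg φ → (𝔄 : Structure n) → ¬ Sat 𝔄 φ →
               Supported 𝔄 (relAtoms φ) (λ 𝔅 → ¬ Sat 𝔅 φ)
    support⁻ {eqF x y} eqN 𝔄 x≢y =
      [] , z≤n , λ 𝔅 (same₁ , _) x≡y → x≢y (trans (sym (same₁ x)) (trans x≡y (same₁ y)))
    support⁻ {relF X m xs} relN 𝔄 fails =
      (X , m , map (I₁ 𝔄) xs) ∷ [] , ≤-refl ,
      λ 𝔅 agree holds → fails (trans (sym (relF-agree X m xs agree)) holds)
    support⁻ {negF φ} (negN φ⁺) 𝔄 ¬¬holds =
      let As , |As| , supported = support⁺ φ⁺ 𝔄 (decidable-stable (sat? 𝔄 φ) ¬¬holds)
      in As , |As| , λ 𝔅 agree ¬holds → ¬holds (supported 𝔅 agree)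
    support⁻ {andF φ ψ} (andN φ⁻ ψ⁻) 𝔄 fails with sat? 𝔄 φ
    ... | no φ-fails = let As , |As| , supported = support⁻ φ⁻ 𝔄 φ-fails
                       in As , ≤-trans |As| (m≤m+n _ _) , λ 𝔅 agree → supported 𝔅 agree ∘ proj₁
    ... | yes φ-holds = let As , |As| , supported = support⁻ ψ⁻ 𝔄 (λ ψ-holds → fails (φ-holds , ψ-holds))
                        in As , ≤-trans |As| (m≤n+m _ _) , λ 𝔅 agree → supported 𝔅 agree ∘ proj₂

Point : ℕ → ∀ {l} → Vec ℕ l → Set
Point n ar = Σ (Fin _) λ i → Vec (Fin (suc n)) (lookup ar i)

_≟Point_ : ∀ {n l} {ar : Vec ℕ l} → DecidableEquality (Point n ar)
_≟Point_ = Product.≡-dec Fin._≟_ (Vec.≡-dec Fin._≟_)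

shiftPoint : ∀ {n l a} {ar : Vec ℕ l} → Point n ar → Point n (a ∷ ar)
shiftPoint (i , w) = suc i , w

-- An atom (y , m , v) reads the point (i , v) of a tuple substituted for X when
-- (y , m) is the first variable (X_i , ar_i) of that name and arity, as in updI₂.
readBy : ∀ {n l} (ar X : Vec ℕ l) → Atom n → List (Point n ar)
readBy []       []      _           = []
readBy (a ∷ ar) (x ∷ X) (y , m , v) with x ≟ y | a ≟ m
... | yes _ | yes refl = (zero , v) ∷ []
... | _     | _        = List.map shiftPoint (readBy ar X (y , m , v))

length-readBy : ∀ {n l} (ar X : Vec ℕ l) (atom : Atom n) → length (readBy ar X atom) ≤ 1
length-readBy []       []      _           = z≤n
length-readBy (a ∷ ar) (x ∷ X) (y , m , v) with x ≟ y | a ≟ m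
... | yes _ | yes refl = ≤-refl
... | yes _ | no _     = ≤-trans (≤-reflexive (length-map (shiftPoint {a = a} {ar = ar}) (readBy ar X (y , m , v))))
                                 (length-readBy ar X (y , m , v))
... | no _  | _        = ≤-trans (≤-reflexive (length-map (shiftPoint {a = a} {ar = ar}) (readBy ar X (y , m , v))))
                                 (length-readBy ar X (y , m , v))

updI₂-agree : ∀ {n l} (ar X : Vec ℕ l) {B C : RelTuple n ar} {I J : ℕ → (m : ℕ) → Rel n m} y m v →
              Agree (readBy ar X (y , m , v)) (uncurry C) (uncurry B) → J y m v ≡ I y m v →
              updI₂ ar X C J y m v ≡ updI₂ ar X B I y m v
updI₂-agree []       []      y m v _     same = same
updI₂-agree (a ∷ ar) (x ∷ X) y m v agree same with x ≟ y | a ≟ m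
... | yes _ | yes refl = agree (here refl)
... | yes _ | no _     = updI₂-agree ar X y m v (agree ∘ ∈-map⁺ (shiftPoint {a = a} {ar = ar})) same
... | no _  | _        = updI₂-agree ar X y m v (agree ∘ ∈-map⁺ (shiftPoint {a = a} {ar = ar})) same

length-concatMap-≤ : ∀ {A B : Set} (f : A → List B) {k} → (∀ x → length (f x) ≤ k) →
                     ∀ xs → length (concatMap f xs) ≤ length xs * k
length-concatMap-≤ f short []       = z≤n
length-concatMap-≤ f short (x ∷ xs) =
  ≤-trans (≤-reflexive (length-++ (f x))) (+-mono-≤ (short x) (length-concatMap-≤ f short xs))

module _ {n l} (𝔄 : Structure n) (ar X X′ : Vec ℕ l) (θ : Formula) where

  StepOnPoints : (Point n ar → Bool) → (Point n ar → Bool) → Set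
  StepOnPoints B B′ = Step 𝔄 ar X X′ θ (curry B) (curry B′)

  readByStep : Atom n → List (Point n ar)
  readByStep atom = readBy ar X atom ++ readBy ar X′ atom

  length-readByStep : ∀ atom → length (readByStep atom) ≤ 2
  length-readByStep atom = ≤-trans (≤-reflexive (length-++ (readBy ar X atom)))
                                   (+-mono-≤ (length-readBy ar X atom) (length-readBy ar X′ atom))

  step-local : Pos θ → Local (relAtoms θ * 2) StepOnPoints
  step-local θ⁺ step =
    let As , |As| , supported = support⁺ θ⁺ _ step
    in concatMap readByStep As ,
       ≤-trans (length-concatMap-≤ readByStep length-readByStep As) (*-monoˡ-≤ 2 |As|) ,
       λ agree agree′ → supported _ ((λ _ → refl) , λ atom∈ →
         updI₂-agree ar X _ _ _ (agree ∘ read atom∈ ∘ ∈-++⁺ˡ)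
           (updI₂-agree ar X′ _ _ _ (agree′ ∘ read atom∈ ∘ ∈-++⁺ʳ _) refl))
    where
    read : ∀ {As atom t} → atom ∈ As → t ∈ readByStep atom → t ∈ concatMap readByStep As
    read atom∈ t∈ = ∈-concatMap⁺ readByStep (lose atom∈ t∈)

  Path⇔Walk : ∀ Y Y′ {len} → Path 𝔄 ar X X′ θ Y Y′ len ⇔
              Walk StepOnPoints (uncurry (valT 𝔄 ar Y)) (uncurry (valT 𝔄 ar Y′)) len
  Path⇔Walk Y Y′ = mk⇔ (λ (Bs , first , last , chain) → uncurry ∘ Bs , uncurry first , uncurry last , chain)
                       (λ (s , first , last , chain) → curry ∘ s , curry first , curry last , chain)

mainTheorem2 : ∀ {l} (ar X X' Y Y' : Vec ℕ l) (θ : Formula) →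
    Existential θ → Distinct ar X → Distinct ar X' → Disjoint ar X X' →
    Σ ℕ λ k → ∀ (n : ℕ) (𝔄 : Structure n) →
      (SatTC 𝔄 ar X X' θ Y Y' ⇔ SatTCk k 𝔄 ar X X' θ Y Y')
mainTheorem2 ar X X′ Y Y′ θ θ-existential _ _ _ = k , λ n 𝔄 → mk⇔
    (λ (len , 1≤len , path) → shortenToBound k (shortenPath 𝔄) 1≤len path)
    (λ (len , 1≤len , _ , path) → len , 1≤len , path)
  where
  D : ℕ
  D = relAtoms θ * 2
  k : ℕ
  k = suc (compatBound (D + D))
  shortenPath : ∀ {n} (𝔄 : Structure n) {len} → k < len → Path 𝔄 ar X X′ θ Y Y′ len →
                Σ ℕ λ len′ → 1 ≤ len′ × len′ < len × Path 𝔄 ar X X′ θ Y Y′ len′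
  shortenPath 𝔄 k<len path =
    let len′ , 1≤len′ , len′<len , walk =
          shorten (_≟Point_ {ar = ar}) (step-local 𝔄 ar X X′ θ θ-existential) k<len
                  (Equivalence.to (Path⇔Walk 𝔄 ar X X′ θ Y Y′) path)
    in len′ , 1≤len′ , len′<len , Equivalence.from (Path⇔Walk 𝔄 ar X X′ θ Y Y′) walk
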